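{- Let $k$ be a positive integer and let $A,B$ be disjoint vertex sets in a tournament. If $d(A,B)\ge\beta$ for some $0<\beta\le 1/2$, and $|A|,|B|\ge \beta^{ -5k}$, then there are subsets $X\subseteq A$ and $Y\subseteq B$ with $|X|\ge \beta^{4k}|A|$ and $|Y|=k$ such that $Y$ induces a transitive tournament and $X\Rightarrow Y$.
   Context: A tournament is a complete graph with every edge oriented. It is transitive if its vertices can be ordered so that every edge is oriented from the earlier to the later vertex. For vertex sets $A,B$, $e(A,B)$ is the number of edges oriented from $A$ to $B$ and $d(A,B)=e(A,B)/(|A||B|)$. We write $A\Rightarrow B$ if $A$ and $B$ are disjoint and every vertex of $A$ has an edge oriented to every vertex of $B$.
   Formalization: The parameter β, with $0<\beta\le 1/2$, is taken over the rationals. -}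

module Defs where

open import Data.Nat as ℕ using (ℕ; zero; suc)
open import Data.Bool using (Bool; true; false; not)
open import Data.Fin as F using (Fin; _<_)
open import Data.Fin.Subset using (Subset; _∈_; _∩_; ∣_∣; Empty)
open import Data.Fin.Subset.Properties using (_∈?_)
open import Data.Integer using (+_)
open import Data.Rational as ℚ using (ℚ; 1ℚ; _/_)
open import Data.Product using (Σ; ∃; _×_; _,_)
open import Function using (Injective; _⇔_)
open import Relation.Binary.PropositionalEquality using (_≡_; _≢_)
open import Relation.Nullary using (does)

-- A tournament on the vertex set Fin n: an orientation of the complete graph.
-- edge u v ≡ true  means the edge between u and v is oriented from u to v.
record Tournament (n : ℕ) : Set where
  field
    edge    : Fin n → Fin n → Bool
    irrefl  : ∀ u → edge u u ≡ false
    orient  : ∀ u v → u ≢ v → edge u v ≡ not (edge v u)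
open Tournament public

𝟙 : Bool → ℕ
𝟙 true  = 1
𝟙 false = 0

∑ : ∀ {n} → (Fin n → ℕ) → ℕ
∑ {zero}  f = 0
∑ {suc n} f = f F.zero ℕ.+ ∑ (λ i → f (F.suc i))

e : ∀ {n} → Tournament n → Subset n → Subset n → ℕ
e T A B = ∑ (λ u → ∑ (λ v →
  𝟙 (does (u ∈? A)) ℕ.* 𝟙 (does (v ∈? B)) ℕ.* 𝟙 (edge T u v)))

ℕtoℚ : ℕ → ℚ
ℕtoℚ m = + m / 1

Disjoint : ∀ {n} → Subset n → Subset n → Set
Disjoint A B = Empty (A ∩ B)

_⇒_ : ∀ {n} → Tournament n → Subset n → Subset n → Set
_⇒_ T A B = Disjoint A B × (∀ u v → u ∈ A → v ∈ B → edge T u v ≡ true)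

Transitive : ∀ {n} → Tournament n → Subset n → Set
Transitive {n} T Y =
  Σ (Fin ∣ Y ∣ → Fin n) λ σ →
    Injective _≡_ _≡_ σ
    × (∀ v → v ∈ Y ⇔ ∃ λ i → σ i ≡ v)
    × (∀ i j → i < j → edge T (σ i) (σ j) ≡ true)

_^_ : ℚ → ℕ → ℚ
q ^ zero  = 1ℚ
q ^ suc m = q ℚ.* (q ^ m)

module Submission where

-- Write β = p / q. Discard the vertices of A with out-degree below (3/4)β|B| into B;
-- double counting e(A, B) shows that the remaining set A₀ keeps a β / (4 - 3β) fraction of A.
-- The transitive tournament is then built greedily, one vertex y ∈ B at a time. A tournament
-- on L has average out-degree (|L| - 1)/2, so only few vertices of B have few out- or
-- in-neighbours in B; averaging over the remaining ones gives a y with many in-neighbours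
-- a ∈ A₀, and each such a is still dense in N⁺(y) or in N⁻(y), since these two sets and y
-- make up B. Recursing on the larger half inside N⁺(y) (y placed first) or N⁻(y) (y placed
-- last) costs a factor β⁴ in |A| and β⁵ in |B| per vertex.

module Counting where

  open import Defs using (𝟙; ∑)
  open import Data.Bool using (Bool; true; false; not; _∧_; T)
  open import Data.Bool.Properties using (T-∧)
  open import Data.Empty using (⊥-elim)
  open import Data.Fin using (Fin; zero; suc; _≟_)
  open import Data.Nat using (ℕ; zero; suc; _+_; _*_; _≤_; _<_; z≤n; s≤s)
  open import Data.Nat.Properties hiding (_≟_)
  open import Algebra.Properties.CommutativeSemigroup +-commutativeSemigroup using (interchange)
  open import Algebra.Properties.CommutativeSemigroup *-commutativeSemigroup using (x∙yz≈y∙xz)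
  open import Data.Product using (∃; _×_; _,_; proj₁; proj₂)
  open import Data.Unit using (tt)
  open import Function using (_∘_; Equivalence)
  open import Relation.Binary.PropositionalEquality
  open import Relation.Nullary using (does; yes; no)

  private variable n m : ℕ

  ∑-cong : {f g : Fin n → ℕ} → (∀ i → f i ≡ g i) → ∑ f ≡ ∑ g
  ∑-cong {zero}  f≗g = refl
  ∑-cong {suc n} f≗g = cong₂ _+_ (f≗g zero) (∑-cong (f≗g ∘ suc))

  ∑-mono-≤ : {f g : Fin n → ℕ} → (∀ i → f i ≤ g i) → ∑ f ≤ ∑ g
  ∑-mono-≤ {zero}  f≤g = z≤n
  ∑-mono-≤ {suc n} f≤g = +-mono-≤ (f≤g zero) (∑-mono-≤ (f≤g ∘ suc))

  ∑-zero : ∑ {n} (λ _ → 0) ≡ 0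
  ∑-zero {zero}  = refl
  ∑-zero {suc n} = ∑-zero {n}

  ∑-distrib-+ : (f g : Fin n → ℕ) → ∑ (λ i → f i + g i) ≡ ∑ f + ∑ g
  ∑-distrib-+ {zero}  f g = refl
  ∑-distrib-+ {suc n} f g = begin
    f zero + g zero + ∑ (λ i → f (suc i) + g (suc i))  ≡⟨ cong (f zero + g zero +_) (∑-distrib-+ (f ∘ suc) (g ∘ suc)) ⟩
    f zero + g zero + (∑ (f ∘ suc) + ∑ (g ∘ suc))      ≡⟨ interchange (f zero) (g zero) _ _ ⟩
    f zero + ∑ (f ∘ suc) + (g zero + ∑ (g ∘ suc))      ∎
    where open ≡-Reasoning

  *-distribˡ-∑ : (c : ℕ) (f : Fin n → ℕ) → ∑ (λ i → c * f i) ≡ c * ∑ f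
  *-distribˡ-∑ {zero}  c f = sym (*-zeroʳ c)
  *-distribˡ-∑ {suc n} c f =
    trans (cong (c * f zero +_) (*-distribˡ-∑ c (f ∘ suc))) (sym (*-distribˡ-+ c (f zero) _))

  ∑-comm : (f : Fin n → Fin m → ℕ) → ∑ (λ i → ∑ (λ j → f i j)) ≡ ∑ (λ j → ∑ (λ i → f i j))
  ∑-comm {zero}  {m} f = sym (∑-zero {m})
  ∑-comm {suc n} {m} f = begin
    ∑ (f zero) + ∑ (λ i → ∑ (f (suc i)))          ≡⟨ cong (∑ (f zero) +_) (∑-comm (f ∘ suc)) ⟩
    ∑ (f zero) + ∑ (λ j → ∑ (λ i → f (suc i) j))  ≡⟨ sym (∑-distrib-+ (f zero) _) ⟩
    ∑ (λ j → f zero j + ∑ (λ i → f (suc i) j))    ∎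
    where open ≡-Reasoning

  δ : Fin n → Fin n → Bool
  δ u v = does (u ≟ v)

  ∑-δ : (u : Fin n) (f : Fin n → ℕ) → ∑ (λ v → 𝟙 (δ u v) * f v) ≡ f u
  ∑-δ {suc n} zero f = begin
    f zero + 0 + ∑ {n} (λ _ → 0)  ≡⟨ cong (f zero + 0 +_) (∑-zero {n}) ⟩
    f zero + 0 + 0                ≡⟨ trans (+-identityʳ _) (+-identityʳ _) ⟩
    f zero                        ∎
    where open ≡-Reasoning
  ∑-δ {suc n} (suc u) f = trans (∑-cong δ-suc) (∑-δ u (f ∘ suc))
    where
    δ-suc : ∀ v → 𝟙 (δ (suc u) (suc v)) * f (suc v) ≡ 𝟙 (δ u v) * f (suc v)
    δ-suc v with u ≟ v
    ... | yes _ = refl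
    ... | no  _ = refl

  𝟙≤1 : ∀ b → 𝟙 b ≤ 1
  𝟙≤1 true  = s≤s z≤n
  𝟙≤1 false = z≤n

  𝟙-T : ∀ b → T b → 𝟙 b ≡ 1
  𝟙-T true _ = refl

  𝟙-T-* : ∀ b {x} → T b → 𝟙 b * x ≡ x
  𝟙-T-* true _ = *-identityˡ _

  𝟙-∧ : ∀ a b → 𝟙 (a ∧ b) ≡ 𝟙 a * 𝟙 b
  𝟙-∧ true  b = sym (+-identityʳ (𝟙 b))
  𝟙-∧ false b = refl

  𝟙-split : ∀ a b → 𝟙 a ≡ 𝟙 (a ∧ b) + 𝟙 (a ∧ not b)
  𝟙-split true  true  = refl
  𝟙-split true  false = refl
  𝟙-split false b     = refl

  ∧-elimˡ : ∀ {x y} → T (x ∧ y) → T x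
  ∧-elimˡ {x} = proj₁ ∘ Equivalence.to (T-∧ {x})

  ∧-elimʳ : ∀ {x y} → T (x ∧ y) → T y
  ∧-elimʳ {x} = proj₂ ∘ Equivalence.to (T-∧ {x})

  -- Vertex sets are handled as characteristic functions, which makes sets such as
  -- "the out-neighbours of y in B" definable by a one-line formula.
  VSet : ℕ → Set
  VSet n = Fin n → Bool

  _⊆ᵥ_ : VSet n → VSet n → Set
  A ⊆ᵥ B = ∀ v → T (A v) → T (B v)

  # : VSet n → ℕ
  # S = ∑ (𝟙 ∘ S)

  ∑∈ : VSet n → (Fin n → ℕ) → ℕ
  ∑∈ S f = ∑ (λ v → 𝟙 (S v) * f v)

  ∑∈-cong : (S : VSet n) {f g : Fin n → ℕ} → (∀ v → f v ≡ g v) → ∑∈ S f ≡ ∑∈ S g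
  ∑∈-cong S f≗g = ∑-cong λ v → cong (𝟙 (S v) *_) (f≗g v)

  ∑∈-mono-≤ : (S : VSet n) {f g : Fin n → ℕ} → (∀ v → T (S v) → f v ≤ g v) → ∑∈ S f ≤ ∑∈ S g
  ∑∈-mono-≤ S {f} {g} f≤g = ∑-mono-≤ pointwise
    where
    pointwise : ∀ v → 𝟙 (S v) * f v ≤ 𝟙 (S v) * g v
    pointwise v with S v | f≤g v
    ... | false | _   = z≤n
    ... | true  | f≤g = *-monoʳ-≤ 1 (f≤g _)

  ∑∈-mono-⊆ : {A B : VSet n} (f : Fin n → ℕ) → A ⊆ᵥ B → ∑∈ A f ≤ ∑∈ B f
  ∑∈-mono-⊆ {A = A} {B} f A⊆B = ∑-mono-≤ pointwise
    where
    pointwise : ∀ v → 𝟙 (A v) * f v ≤ 𝟙 (B v) * f v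
    pointwise v with A v | B v | A⊆B v
    ... | false | _     | _   = z≤n
    ... | true  | true  | _   = ≤-refl
    ... | true  | false | A⊆B = ⊥-elim (A⊆B _)

  ∑∈-distrib-+ : (S : VSet n) (f g : Fin n → ℕ) → ∑∈ S (λ v → f v + g v) ≡ ∑∈ S f + ∑∈ S g
  ∑∈-distrib-+ S f g = trans (∑-cong λ v → *-distribˡ-+ (𝟙 (S v)) (f v) (g v))
                             (∑-distrib-+ (λ v → 𝟙 (S v) * f v) (λ v → 𝟙 (S v) * g v))

  ∑∈-*ˡ : (S : VSet n) (c : ℕ) (f : Fin n → ℕ) → ∑∈ S (λ v → c * f v) ≡ c * ∑∈ S f
  ∑∈-*ˡ S c f = trans (∑-cong λ v → x∙yz≈y∙xz (𝟙 (S v)) c (f v)) (*-distribˡ-∑ c (λ v → 𝟙 (S v) * f v))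

  ∑∈-const : (S : VSet n) (c : ℕ) → ∑∈ S (λ _ → c) ≡ c * # S
  ∑∈-const S c = trans (∑-cong λ v → *-comm (𝟙 (S v)) c) (*-distribˡ-∑ c (𝟙 ∘ S))

  ∑∈-partition : (S g : VSet n) (f : Fin n → ℕ) →
                 ∑∈ S f ≡ ∑∈ (λ v → S v ∧ g v) f + ∑∈ (λ v → S v ∧ not (g v)) f
  ∑∈-partition S g f =
    trans (∑-cong λ v → trans (cong (_* f v) (𝟙-split (S v) (g v))) (*-distribʳ-+ (f v) (𝟙 (S v ∧ g v)) _))
          (∑-distrib-+ (λ v → 𝟙 (S v ∧ g v) * f v) (λ v → 𝟙 (S v ∧ not (g v)) * f v))

  #≡∑∈1 : (S : VSet n) → # S ≡ ∑∈ S (λ _ → 1)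
  #≡∑∈1 S = sym (trans (∑∈-const S 1) (*-identityˡ (# S)))

  #-mono-⊆ : {A B : VSet n} → A ⊆ᵥ B → # A ≤ # B
  #-mono-⊆ {A = A} {B} A⊆B = subst₂ _≤_ (sym (#≡∑∈1 A)) (sym (#≡∑∈1 B)) (∑∈-mono-⊆ (λ _ → 1) A⊆B)

  #-partition : (S g : VSet n) → # S ≡ # (λ v → S v ∧ g v) + # (λ v → S v ∧ not (g v))
  #-partition S g = trans (∑-cong λ v → 𝟙-split (S v) (g v))
                          (∑-distrib-+ (λ v → 𝟙 (S v ∧ g v)) (λ v → 𝟙 (S v ∧ not (g v))))

  ∑∑ : VSet n → VSet n → (Fin n → Fin n → ℕ) → ℕ
  ∑∑ A B h = ∑ (λ u → ∑ (λ v → 𝟙 (A u) * 𝟙 (B v) * h u v))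

  ∑∑-cong : (A B : VSet n) {g h : Fin n → Fin n → ℕ} → (∀ u v → g u v ≡ h u v) → ∑∑ A B g ≡ ∑∑ A B h
  ∑∑-cong A B g≗h = ∑-cong λ u → ∑-cong λ v → cong (𝟙 (A u) * 𝟙 (B v) *_) (g≗h u v)

  ∑∑-∑∈ : (A B : VSet n) (h : Fin n → Fin n → ℕ) → ∑∑ A B h ≡ ∑∈ A (λ u → ∑∈ B (h u))
  ∑∑-∑∈ A B h = ∑-cong λ u →
    trans (∑-cong λ v → *-assoc (𝟙 (A u)) (𝟙 (B v)) (h u v)) (*-distribˡ-∑ (𝟙 (A u)) (λ v → 𝟙 (B v) * h u v))

  ∑∑-distrib-+ : (A B : VSet n) (g h : Fin n → Fin n → ℕ) →
                 ∑∑ A B (λ u v → g u v + h u v) ≡ ∑∑ A B g + ∑∑ A B h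
  ∑∑-distrib-+ A B g h =
    trans (∑-cong λ u → trans (∑-cong λ v → *-distribˡ-+ (𝟙 (A u) * 𝟙 (B v)) (g u v) (h u v))
                              (∑-distrib-+ (λ v → 𝟙 (A u) * 𝟙 (B v) * g u v) (λ v → 𝟙 (A u) * 𝟙 (B v) * h u v)))
          (∑-distrib-+ (λ u → ∑ (λ v → 𝟙 (A u) * 𝟙 (B v) * g u v)) (λ u → ∑ (λ v → 𝟙 (A u) * 𝟙 (B v) * h u v)))

  ∑∑-comm : (A B : VSet n) (h : Fin n → Fin n → ℕ) → ∑∑ A B (λ u v → h v u) ≡ ∑∑ B A h
  ∑∑-comm A B h = trans (∑-comm (λ u v → 𝟙 (A u) * 𝟙 (B v) * h v u))
                        (∑-cong λ v → ∑-cong λ u → cong (_* h v u) (*-comm (𝟙 (A u)) (𝟙 (B v))))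

  ∑∑-const : (A B : VSet n) → ∑∑ A B (λ _ _ → 1) ≡ # A * # B
  ∑∑-const A B = begin
    ∑∑ A B (λ _ _ → 1)               ≡⟨ ∑∑-∑∈ A B _ ⟩
    ∑∈ A (λ _ → ∑∈ B (λ _ → 1))      ≡⟨ ∑∈-const A _ ⟩
    ∑∈ B (λ _ → 1) * # A             ≡⟨ cong (_* # A) (sym (#≡∑∈1 B)) ⟩
    # B * # A                        ≡⟨ *-comm (# B) (# A) ⟩
    # A * # B                        ∎
    where open ≡-Reasoning

  ∑∑-δ : (A : VSet n) → ∑∑ A A (λ u v → 𝟙 (δ u v)) ≡ # A
  ∑∑-δ A = trans (∑∑-∑∈ A A _) (∑-cong λ u → trans (cong (𝟙 (A u) *_) (diagonal u)) (𝟙-idem (A u)))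
    where
    diagonal : ∀ u → ∑∈ A (λ v → 𝟙 (δ u v)) ≡ 𝟙 (A u)
    diagonal u = trans (∑-cong λ v → *-comm (𝟙 (A v)) _) (∑-δ u (𝟙 ∘ A))
    𝟙-idem : ∀ b → 𝟙 b * 𝟙 b ≡ 𝟙 b
    𝟙-idem true  = refl
    𝟙-idem false = refl

  argmax : (f : Fin (suc n) → ℕ) → ∃ λ y → ∀ v → f v ≤ f y
  argmax {zero}  f = zero , λ { zero → ≤-refl }
  argmax {suc n} f with argmax (f ∘ suc)
  ... | y , max with f zero ≤? f (suc y)
  ...   | yes f0≤ = suc y , λ { zero → f0≤ ; (suc v) → max v }
  ...   | no  f0≰ = zero  , λ { zero → ≤-refl ; (suc v) → ≤-trans (max v) (<⇒≤ (≰⇒> f0≰)) }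

  ∃-≥-average : (S : VSet n) (f : Fin n → ℕ) → 0 < ∑∈ S f → ∃ λ y → T (S y) × ∑∈ S f ≤ # S * f y
  ∃-≥-average {zero}  S f ()
  ∃-≥-average {suc n} S f positive with argmax (λ v → 𝟙 (S v) * f v)
  ... | y , max = y , y∈S , ≤-trans sum≤ (≤-reflexive (cong (# S *_) (𝟙-T-* (S y) y∈S)))
    where
    bounded : ∀ v → T (S v) → f v ≤ 𝟙 (S y) * f y
    bounded v v∈S = ≤-trans (≤-reflexive (sym (𝟙-T-* (S v) v∈S))) (max v)
    sum≤ : ∑∈ S f ≤ # S * (𝟙 (S y) * f y)
    sum≤ = ≤-trans (∑∈-mono-≤ S bounded) (≤-reflexive (trans (∑∈-const S _) (*-comm _ (# S))))
    y∈S : T (S y)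
    y∈S with S y | sum≤
    ... | true  | _    = tt
    ... | false | sum≤ = ⊥-elim (<⇒≱ positive (≤-trans sum≤ (≤-reflexive (*-zeroʳ (# S)))))


module Tournaments where

  open import Defs using (Tournament; edge; irrefl; orient; 𝟙; ∑)
  open Counting
  open import Data.Bool using (true; false; _∧_; T)
  open import Data.Fin using (Fin; _≟_)
  open import Data.Nat using (ℕ; zero; suc; _+_; _*_; _≤_; z≤n)
  open import Data.Nat.Properties hiding (_≟_)
  open import Data.Nat.Tactic.RingSolver using (solve-∀)
  open import Function using (_∘_)
  open import Relation.Binary.PropositionalEquality
  open import Relation.Nullary using (yes; no)

  reverse : ∀ {n} → Tournament n → Tournament n
  reverse τ = record
    { edge   = λ u v → edge τ v u
    ; irrefl = irrefl τ
    ; orient = λ u v u≢v → orient τ v u (u≢v ∘ sym)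
    }

  module Degrees {n : ℕ} (τ : Tournament n) where

    E : Fin n → Fin n → ℕ
    E u v = 𝟙 (edge τ u v)

    deg : Fin n → VSet n → ℕ
    deg u B = ∑∈ B (E u)

    deg≤# : ∀ u B → deg u B ≤ # B
    deg≤# u B = ≤-trans (∑∈-mono-≤ B (λ v _ → 𝟙≤1 (edge τ u v))) (≤-reflexive (sym (#≡∑∈1 B)))

    E-total : ∀ u v → E u v + E v u + 𝟙 (δ u v) ≡ 1
    E-total u v with u ≟ v
    ... | yes refl rewrite irrefl τ u = refl
    ... | no u≢v with edge τ u v | edge τ v u | orient τ u v u≢v
    ...   | true  | false | _  = refl
    ...   | false | true  | _  = refl
    ...   | true  | true  | ()
    ...   | false | false | ()

    edges-within : (L : VSet n) → ∑∑ L L E + ∑∑ L L E + # L ≡ # L * # L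
    edges-within L = begin
      ∑∑ L L E + ∑∑ L L E + # L
        ≡⟨ cong₂ (λ x y → ∑∑ L L E + x + y) (sym (∑∑-comm L L E)) (sym (∑∑-δ L)) ⟩
      ∑∑ L L E + ∑∑ L L (λ u v → E v u) + ∑∑ L L (λ u v → 𝟙 (δ u v))
        ≡⟨ cong (_+ ∑∑ L L (λ u v → 𝟙 (δ u v))) (sym (∑∑-distrib-+ L L E (λ u v → E v u))) ⟩
      ∑∑ L L (λ u v → E u v + E v u) + ∑∑ L L (λ u v → 𝟙 (δ u v))
        ≡⟨ sym (∑∑-distrib-+ L L _ _) ⟩
      ∑∑ L L (λ u v → E u v + E v u + 𝟙 (δ u v))
        ≡⟨ ∑∑-cong L L E-total ⟩
      ∑∑ L L (λ _ _ → 1)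
        ≡⟨ ∑∑-const L L ⟩
      # L * # L ∎
      where open ≡-Reasoning

    -- L spans |L|(|L|-1)/2 edges, so its average out-degree is (|L|-1)/2.
    #-low-outdegree : (L B : VSet n) (P M : ℕ) → L ⊆ᵥ B →
                      (∀ u → T (L u) → P * deg u B ≤ M) → P * # L ≤ P + 2 * M
    #-low-outdegree L B P M L⊆B low = cancel (# L) squares
      where
      open ≤-Reasoning
      edges≤ : P * ∑∑ L L E ≤ M * # L
      edges≤ = begin
        P * ∑∑ L L E                     ≡⟨ cong (P *_) (∑∑-∑∈ L L E) ⟩
        P * ∑∈ L (λ u → deg u L)         ≤⟨ *-monoʳ-≤ P (∑∈-mono-≤ L λ u _ → ∑∈-mono-⊆ (E u) L⊆B) ⟩
        P * ∑∈ L (λ u → deg u B)         ≡⟨ sym (∑∈-*ˡ L P (λ u → deg u B)) ⟩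
        ∑∈ L (λ u → P * deg u B)         ≤⟨ ∑∈-mono-≤ L low ⟩
        ∑∈ L (λ _ → M)                   ≡⟨ ∑∈-const L M ⟩
        M * # L                          ∎
      squares : P * (# L * # L) ≤ (P + 2 * M) * # L
      squares = begin
        P * (# L * # L)                                ≡⟨ cong (P *_) (sym (edges-within L)) ⟩
        P * (∑∑ L L E + ∑∑ L L E + # L)                 ≡⟨ expand P (∑∑ L L E) (# L) ⟩
        P * ∑∑ L L E + P * ∑∑ L L E + P * # L           ≤⟨ +-monoˡ-≤ (P * # L) (+-mono-≤ edges≤ edges≤) ⟩
        M * # L + M * # L + P * # L                     ≡⟨ collect M P (# L) ⟩
        (P + 2 * M) * # L                              ∎
        where
        expand : ∀ p x l → p * (x + x + l) ≡ p * x + p * x + p * l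
        expand = solve-∀
        collect : ∀ m p l → m * l + m * l + p * l ≡ (p + 2 * m) * l
        collect = solve-∀
      cancel : ∀ l → P * (l * l) ≤ (P + 2 * M) * l → P * l ≤ P + 2 * M
      cancel zero    _  = ≤-trans (≤-reflexive (*-zeroʳ P)) z≤n
      cancel (suc l) le = *-cancelʳ-≤ (P * suc l) (P + 2 * M) (suc l)
                            (≤-trans (≤-reflexive (*-assoc P (suc l) (suc l))) le)

    N⁺ N⁻ : Fin n → VSet n → VSet n
    N⁺ y B v = B v ∧ edge τ y v
    N⁻ y B v = B v ∧ edge τ v y

    ∑∈-split-at : (B : VSet n) (y : Fin n) (w : Fin n → ℕ) →
                  ∑∈ B w ≡ 𝟙 (B y) * w y + ∑∈ (N⁺ y B) w + ∑∈ (N⁻ y B) w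
    ∑∈-split-at B y w = begin
      ∑∈ B w                                          ≡⟨ ∑-cong pointwise ⟩
      ∑ (λ v → at-y v + out v + into v)               ≡⟨ ∑-distrib-+ (λ v → at-y v + out v) into ⟩
      ∑ (λ v → at-y v + out v) + ∑ into               ≡⟨ cong (_+ ∑ into) (∑-distrib-+ at-y out) ⟩
      ∑ at-y + ∑ out + ∑ into                         ≡⟨ cong (λ x → x + ∑ out + ∑ into) (∑-δ y (λ v → 𝟙 (B v) * w v)) ⟩
      𝟙 (B y) * w y + ∑∈ (N⁺ y B) w + ∑∈ (N⁻ y B) w  ∎
      where
      open ≡-Reasoning
      at-y out into : Fin n → ℕ
      at-y v = 𝟙 (δ y v) * (𝟙 (B v) * w v)
      out  v = 𝟙 (N⁺ y B v) * w v
      into v = 𝟙 (N⁻ y B v) * w v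
      distribute : ∀ o i d b x → (o + i + d) * (b * x) ≡ d * (b * x) + b * o * x + b * i * x
      distribute = solve-∀
      pointwise : ∀ v → 𝟙 (B v) * w v ≡ at-y v + out v + into v
      pointwise v = begin
        𝟙 (B v) * w v                                            ≡⟨ sym (*-identityˡ _) ⟩
        1 * (𝟙 (B v) * w v)                                      ≡⟨ cong (_* (𝟙 (B v) * w v)) (sym (E-total y v)) ⟩
        (E y v + E v y + 𝟙 (δ y v)) * (𝟙 (B v) * w v)             ≡⟨ distribute (E y v) (E v y) (𝟙 (δ y v)) (𝟙 (B v)) (w v) ⟩
        at-y v + 𝟙 (B v) * E y v * w v + 𝟙 (B v) * E v y * w v   ≡⟨ cong₂ (λ o i → at-y v + o * w v + i * w v)
                                                                           (sym (𝟙-∧ (B v) _)) (sym (𝟙-∧ (B v) _)) ⟩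
        at-y v + out v + into v                                  ∎

    #-split-at : (B : VSet n) (y : Fin n) → T (B y) → # B ≡ 1 + # (N⁺ y B) + # (N⁻ y B)
    #-split-at B y y∈B = begin
      # B                                                           ≡⟨ #≡∑∈1 B ⟩
      ∑∈ B (λ _ → 1)                                                ≡⟨ ∑∈-split-at B y (λ _ → 1) ⟩
      𝟙 (B y) * 1 + ∑∈ (N⁺ y B) (λ _ → 1) + ∑∈ (N⁻ y B) (λ _ → 1)  ≡⟨ cong₂ (λ x z → x + z + ∑∈ (N⁻ y B) (λ _ → 1))
                                                                              (𝟙-T-* (B y) y∈B) (sym (#≡∑∈1 (N⁺ y B))) ⟩
      1 + # (N⁺ y B) + ∑∈ (N⁻ y B) (λ _ → 1)                        ≡⟨ cong (1 + # (N⁺ y B) +_) (sym (#≡∑∈1 (N⁻ y B))) ⟩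
      1 + # (N⁺ y B) + # (N⁻ y B)                                   ∎
      where open ≡-Reasoning

    deg-split-at : (B : VSet n) (a y : Fin n) → T (B y) → T (edge τ a y) →
                   deg a B ≡ 1 + deg a (N⁺ y B) + deg a (N⁻ y B)
    deg-split-at B a y y∈B a→y = trans (∑∈-split-at B y (E a))
      (cong (λ x → x + deg a (N⁺ y B) + deg a (N⁻ y B)) (trans (𝟙-T-* (B y) y∈B) (𝟙-T (edge τ a y) a→y)))

    #N⁺≡deg : ∀ y B → # (N⁺ y B) ≡ deg y B
    #N⁺≡deg y B = ∑-cong λ v → 𝟙-∧ (B v) _

    #N⁻≡indeg : ∀ y B → # (N⁻ y B) ≡ ∑∈ B (λ v → E v y)
    #N⁻≡indeg y B = ∑-cong λ v → 𝟙-∧ (B v) _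

    ∑-in-degrees : (A B : VSet n) → ∑∈ B (λ y → # (N⁻ y A)) ≡ ∑∈ A (λ a → deg a B)
    ∑-in-degrees A B = begin
      ∑∈ B (λ y → # (N⁻ y A))           ≡⟨ ∑∈-cong B (λ y → #N⁻≡indeg y A) ⟩
      ∑∈ B (λ y → ∑∈ A (λ a → E a y))   ≡⟨ sym (∑∑-∑∈ B A (λ y a → E a y)) ⟩
      ∑∑ B A (λ y a → E a y)            ≡⟨ ∑∑-comm B A E ⟩
      ∑∑ A B E                          ≡⟨ ∑∑-∑∈ A B E ⟩
      ∑∈ A (λ a → deg a B)              ∎
      where open ≡-Reasoning


module Arithmetic where

  open import Data.List using ([]; _∷_)
  open import Data.Bool using (false; not; T)
  open import Data.Nat using (zero; suc; _+_; _*_; _^_; _≤_; _<_; _≤ᵇ_; z≤n; s≤s; >-nonZero)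
  open import Data.Nat.Properties
  open import Data.Nat.Tactic.RingSolver using (solve; solve-∀)
  open import Data.Product using (∃; _,_)
  open import Relation.Binary.PropositionalEquality

  -- Below, p / q stands for β ≤ 1/2 and the other letters for sizes of vertex sets and degrees.

  open ≤-Reasoning

  *-cancelˡ-≤′ : ∀ {m n} o → 1 ≤ o → o * m ≤ o * n → m ≤ n
  *-cancelˡ-≤′ o 1≤o = *-cancelˡ-≤ o {{>-nonZero 1≤o}}

  1≤*-cancelˡ : ∀ {m} n → 1 ≤ n * m → 1 ≤ m
  1≤*-cancelˡ {zero}  n 1≤n*0 = ≤-trans 1≤n*0 (≤-reflexive (*-zeroʳ n))
  1≤*-cancelˡ {suc m} n _     = s≤s z≤n

  ≰ᵇ⇒> : ∀ {m n} → T (not (m ≤ᵇ n)) → n < m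
  ≰ᵇ⇒> {m} {n} m≰ᵇn with m ≤ᵇ n | ≤⇒≤ᵇ {m} {n}
  ... | false | m≤n⇒⊥ = ≰⇒> m≤n⇒⊥

  ⁴-mono-≤ : ∀ {x y} → x ≤ y → x * x * x * x ≤ y * y * y * y
  ⁴-mono-≤ x≤y = *-mono-≤ (*-mono-≤ (*-mono-≤ x≤y x≤y) x≤y) x≤y

  ³-mono-≤ : ∀ {x y} → x ≤ y → x * x * x ≤ y * y * y
  ³-mono-≤ x≤y = *-mono-≤ (*-mono-≤ x≤y x≤y) x≤y

  1≤^ : ∀ {x} k → 1 ≤ x → 1 ≤ x ^ k
  1≤^ k 1≤x = ≤-trans (≤-reflexive (sym (^-zeroˡ k))) (^-monoˡ-≤ k 1≤x)

  ^-*-suc : ∀ x k i → x ^ (k * suc i) ≡ x ^ (k * i) * x ^ k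
  ^-*-suc x k i = trans (cong (x ^_) (*-suc k i)) (trans (^-distribˡ-+-* x k (k * i)) (*-comm (x ^ k) _))

  ^5≡ : ∀ x → x ^ 5 ≡ x * x * x * x * x
  ^5≡ = λ x → sym (expand x)
    where
    expand : ∀ x → x * x * x * x * x ≡ x * (x * (x * (x * (x * 1))))
    expand = solve-∀

  ^4-suc : ∀ x i → x ^ (4 * suc i) ≡ x ^ (4 * i) * (x * x * x * x)
  ^4-suc x i = trans (^-*-suc x 4 i) (cong (x ^ (4 * i) *_) (sym (expand x)))
    where
    expand : ∀ x → x * x * x * x ≡ x * (x * (x * (x * 1)))
    expand = solve-∀

  ^5-suc : ∀ x i → x ^ (5 * suc i) ≡ x ^ (5 * i) * (x * x * x * x * x)
  ^5-suc x i = trans (^-*-suc x 5 i) (cong (x ^ (5 * i) *_) (^5≡ x))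

  16p⁴≤q⁴ : ∀ {p q} → 2 * p ≤ q → 16 * (p * p * p * p) ≤ q * q * q * q
  16p⁴≤q⁴ {p} {q} 2p≤q = begin
    16 * (p * p * p * p)                 ≡⟨ solve (p ∷ []) ⟩
    2 * p * (2 * p) * (2 * p) * (2 * p)  ≤⟨ ⁴-mono-≤ 2p≤q ⟩
    q * q * q * q                        ∎

  8p³≤q³ : ∀ {p q} → 2 * p ≤ q → 8 * (p * p * p) ≤ q * q * q
  8p³≤q³ {p} {q} 2p≤q = begin
    8 * (p * p * p)              ≡⟨ solve (p ∷ []) ⟩
    2 * p * (2 * p) * (2 * p)    ≤⟨ ³-mono-≤ 2p≤q ⟩
    q * q * q                    ∎

  q⁵≤p⁵b⇒16q≤pb : ∀ {p q b} → 1 ≤ p → 2 * p ≤ q → q * q * q * q * q ≤ p * p * p * p * p * b → 16 * q ≤ p * b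
  q⁵≤p⁵b⇒16q≤pb {p} {q} {b} 1≤p 2p≤q q⁵≤p⁵b = *-cancelˡ-≤′ (p * p * p * p) (⁴-mono-≤ 1≤p) (begin
    p * p * p * p * (16 * q)                  ≡⟨ solve (p ∷ q ∷ []) ⟩
    16 * (p * p * p * p) * q                  ≤⟨ *-monoˡ-≤ q (16p⁴≤q⁴ {p} 2p≤q) ⟩
    q * q * q * q * q                         ≤⟨ q⁵≤p⁵b ⟩
    p * p * p * p * p * b                     ≡⟨ solve (p ∷ b ∷ []) ⟩
    p * p * p * p * (p * b)                   ∎)

  dense-sum-positive : ∀ {p q b A S} → 1 ≤ q → 1 ≤ A → 16 * q ≤ p * b →
                       3 * p * b * A ≤ 4 * q * S + 4 * q * A → 1 ≤ S
  dense-sum-positive {p} {q} {b} {A} {S} 1≤q 1≤A 16q≤pb dense =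
    *-cancelˡ-≤′ (4 * q) (≤-trans 1≤q (m≤n*m q 4)) (+-cancelʳ-≤ (4 * q * A) _ _ (begin
      4 * q * 1 + 4 * q * A    ≤⟨ +-monoˡ-≤ (4 * q * A) (*-monoʳ-≤ (4 * q) 1≤A) ⟩
      4 * q * A + 4 * q * A    ≤⟨ ≤-trans (m≤m+n _ (40 * q * A)) (≤-reflexive (solve (q ∷ A ∷ []))) ⟩
      3 * (16 * q) * A         ≤⟨ *-monoˡ-≤ A (*-monoʳ-≤ 3 16q≤pb) ⟩
      3 * (p * b) * A          ≡⟨ solve (p ∷ b ∷ A ∷ []) ⟩
      3 * p * b * A            ≤⟨ dense ⟩
      4 * q * S + 4 * q * A    ∎))

  base-size : ∀ {p q b A S c} → 1 ≤ q → 16 * q ≤ p * b →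
              3 * p * b * A ≤ 4 * q * S + 4 * q * A → S ≤ b * c → 5 * p * A ≤ 8 * q * c
  base-size {p} {q} {b} {A} {S} {c} 1≤q 16q≤pb dense S≤bc =
    *-cancelˡ-≤′ b 1≤b (+-cancelʳ-≤ (8 * q * A) _ _ (begin
      b * (5 * p * A) + 8 * q * A       ≤⟨ +-monoʳ-≤ (b * (5 * p * A)) (*-monoˡ-≤ A 8q≤pb) ⟩
      b * (5 * p * A) + p * b * A       ≡⟨ solve (b ∷ p ∷ A ∷ []) ⟩
      2 * (3 * p * b * A)               ≤⟨ *-monoʳ-≤ 2 dense ⟩
      2 * (4 * q * S + 4 * q * A)       ≤⟨ *-monoʳ-≤ 2 (+-monoˡ-≤ (4 * q * A) (*-monoʳ-≤ (4 * q) S≤bc)) ⟩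
      2 * (4 * q * (b * c) + 4 * q * A) ≡⟨ solve (q ∷ b ∷ c ∷ A ∷ []) ⟩
      b * (8 * q * c) + 8 * q * A       ∎))
    where
    1≤b : 1 ≤ b
    1≤b = 1≤*-cancelˡ p (≤-trans 1≤q (≤-trans (m≤n*m q 16) 16q≤pb))
    8q≤pb : 8 * q ≤ p * b
    8q≤pb = ≤-trans (*-monoˡ-≤ q (m≤m+n 8 8)) 16q≤pb

  split-dense : ∀ {x y o i d⁺ d⁻} → x * (1 + o + i) ≤ y * (1 + d⁺ + d⁻ + 1) → y * (d⁺ + 1) < x * o →
                x * i ≤ y * (d⁻ + 1)
  split-dense {x} {y} {o} {i} {d⁺} {d⁻} dense sparse⁺ = +-cancelˡ-≤ (x * o) _ _ (begin
    x * o + x * i                    ≤⟨ m≤n+m _ x ⟩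
    x + (x * o + x * i)              ≡⟨ solve (x ∷ o ∷ i ∷ []) ⟩
    x * (1 + o + i)                  ≤⟨ dense ⟩
    y * (1 + d⁺ + d⁻ + 1)            ≡⟨ solve (y ∷ d⁺ ∷ d⁻ ∷ []) ⟩
    y * (d⁺ + 1) + y * (d⁻ + 1)      ≤⟨ +-monoˡ-≤ _ (<⇒≤ sparse⁺) ⟩
    x * o + y * (d⁻ + 1)             ∎)

  low-degree-count : ∀ {P M s₁ s₂ c d} → 1 ≤ P → P * s₁ ≤ P + 2 * M → P * s₂ ≤ P + 2 * M →
                     M * c ≤ P * d → c * (s₁ + s₂) ≤ 2 * c + 4 * d
  low-degree-count {P} {M} {s₁} {s₂} {c} {d} 1≤P Ps₁≤ Ps₂≤ Mc≤Pd = *-cancelˡ-≤′ P 1≤P (begin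
    P * (c * (s₁ + s₂))              ≡⟨ solve (P ∷ c ∷ s₁ ∷ s₂ ∷ []) ⟩
    c * (P * s₁ + P * s₂)            ≤⟨ *-monoʳ-≤ c (+-mono-≤ Ps₁≤ Ps₂≤) ⟩
    c * (P + 2 * M + (P + 2 * M))    ≡⟨ solve (c ∷ P ∷ M ∷ []) ⟩
    2 * (P * c) + 4 * (M * c)        ≤⟨ +-monoʳ-≤ (2 * (P * c)) (*-monoʳ-≤ 4 Mc≤Pd) ⟩
    2 * (P * c) + 4 * (P * d)        ≡⟨ solve (P ∷ c ∷ d ∷ []) ⟩
    P * (2 * c + 4 * d)              ∎)

  degree-loss : ∀ {p q b d s} → 1 ≤ p → 2 * p ≤ q → 16 * q ≤ p * b → 3 * p * b ≤ 4 * q * (d + 1) →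
                q * q * q * q * q * s ≤ 2 * (q * q * q * q * q) + 4 * (p * p * p * p * p * b) →
                q * q * q * q * s + 2 * (p * p * p * p) * b ≤ q * q * q * q * d
  degree-loss {p} {q} {b} {d} {s} 1≤p 2p≤q 16q≤pb dense s≤ =
    *-cancelˡ-≤′ (4 * q) (≤-trans 1≤q (m≤n*m q 4)) (+-cancelʳ-≤ (4 * (q * q * q * q * q)) _ _ (begin
      4 * q * (q * q * q * q * s + 2 * (p * p * p * p) * b) + 4 * (q * q * q * q * q)
        ≡⟨ solve (q ∷ s ∷ p ∷ b ∷ []) ⟩
      4 * (q * q * q * q * q * s) + 8 * q * (p * p * p * p) * b + 4 * (q * q * q * q * q)
        ≤⟨ +-monoˡ-≤ _ (+-monoˡ-≤ _ (*-monoʳ-≤ 4 s≤)) ⟩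
      4 * (2 * (q * q * q * q * q) + 4 * (p * p * p * p * p * b)) + 8 * q * (p * p * p * p) * b
        + 4 * (q * q * q * q * q)
        ≡⟨ solve (q ∷ p ∷ b ∷ []) ⟩
      q * q * q * q * (12 * q) + 16 * (p * p * p * p) * (p * b) + 8 * (p * p * p) * (q * p * b)
        ≤⟨ +-mono-≤ (+-mono-≤ (*-monoʳ-≤ (q * q * q * q) 12q≤pb) (*-monoˡ-≤ (p * b) (16p⁴≤q⁴ {p} 2p≤q)))
                    (*-monoˡ-≤ (q * p * b) (8p³≤q³ {p} 2p≤q)) ⟩
      q * q * q * q * (p * b) + q * q * q * q * (p * b) + q * q * q * (q * p * b)
        ≡⟨ solve (q ∷ p ∷ b ∷ []) ⟩
      q * q * q * q * (3 * p * b)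
        ≤⟨ *-monoʳ-≤ (q * q * q * q) dense ⟩
      q * q * q * q * (4 * q * (d + 1))
        ≡⟨ solve (q ∷ d ∷ []) ⟩
      4 * q * (q * q * q * q * d) + 4 * (q * q * q * q * q) ∎))
    where
    1≤q : 1 ≤ q
    1≤q = ≤-trans 1≤p (≤-trans (m≤n*m p 2) 2p≤q)
    12q≤pb : 12 * q ≤ p * b
    12q≤pb = ≤-trans (*-monoˡ-≤ q (m≤m+n 12 4)) 16q≤pb

  halve : ∀ {x A y b S c c′} → 1 ≤ b → 2 * x * b * A ≤ y * S → S ≤ b * c → c ≤ 2 * c′ → x * A ≤ y * c′
  halve {x} {A} {y} {b} {S} {c} {c′} 1≤b 2xbA≤yS S≤bc c≤2c′ = *-cancelˡ-≤′ (2 * b) (≤-trans 1≤b (m≤n*m b 2)) (begin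
    2 * b * (x * A)       ≡⟨ solve (b ∷ x ∷ A ∷ []) ⟩
    2 * x * b * A         ≤⟨ 2xbA≤yS ⟩
    y * S                 ≤⟨ *-monoʳ-≤ y (≤-trans S≤bc (*-monoʳ-≤ b c≤2c′)) ⟩
    y * (b * (2 * c′))    ≡⟨ solve (y ∷ b ∷ c′ ∷ []) ⟩
    2 * b * (y * c′)      ∎)

  compose-ratios : ∀ {a b u v x y A A′ X} → a * u * A′ ≤ b * v * X → x * A ≤ y * A′ →
                   a * (u * x) * A ≤ b * (v * y) * X
  compose-ratios {a} {b} {u} {v} {x} {y} {A} {A′} {X} X≥A′ A′≥A = begin
    a * (u * x) * A     ≡⟨ solve (a ∷ u ∷ x ∷ A ∷ []) ⟩
    a * u * (x * A)     ≤⟨ *-monoʳ-≤ (a * u) A′≥A ⟩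
    a * u * (y * A′)    ≡⟨ solve (a ∷ u ∷ y ∷ A′ ∷ []) ⟩
    y * (a * u * A′)    ≤⟨ *-monoʳ-≤ y X≥A′ ⟩
    y * (b * v * X)     ≡⟨ solve (y ∷ b ∷ v ∷ X ∷ []) ⟩
    b * (v * y) * X     ∎

  prune : ∀ {p q b A₀ Aᵣ e} → 1 ≤ b → p * ((A₀ + Aᵣ) * b) ≤ q * e →
          4 * q * e ≤ 4 * q * b * A₀ + 3 * p * b * Aᵣ → p * (A₀ + Aᵣ) + 3 * p * A₀ ≤ 4 * q * A₀
  prune {p} {q} {b} {A₀} {Aᵣ} {e} 1≤b dense e≤ = *-cancelˡ-≤′ b 1≤b (+-cancelʳ-≤ (3 * p * b * Aᵣ) _ _ (begin
    b * (p * (A₀ + Aᵣ) + 3 * p * A₀) + 3 * p * b * Aᵣ  ≡⟨ solve (b ∷ p ∷ A₀ ∷ Aᵣ ∷ []) ⟩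
    4 * (p * ((A₀ + Aᵣ) * b))                          ≤⟨ *-monoʳ-≤ 4 dense ⟩
    4 * (q * e)                                        ≡⟨ solve (e ∷ q ∷ []) ⟩
    4 * q * e                                          ≤⟨ e≤ ⟩
    4 * q * b * A₀ + 3 * p * b * Aᵣ                    ≡⟨ solve (q ∷ b ∷ A₀ ∷ p ∷ Aᵣ ∷ []) ⟩
    b * (4 * q * A₀) + 3 * p * b * Aᵣ                  ∎))

  cubic-bound : ∀ {p q t} → 2 * p ≤ q → 3 * p + t ≡ 4 * q → 8 * (p * p) * t ≤ 5 * (q * q * q)
  cubic-bound {p} {q} {t} 2p≤q 3p+t≡4q with m≤n⇒∃[o]m+o≡n 2p≤q
  ... | r , refl = begin
    8 * (p * p) * t                ≡⟨ cong (8 * (p * p) *_) t≡5p+4r ⟩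
    8 * (p * p) * (5 * p + 4 * r)  ≤⟨ m≤m+n _ (28 * (p * p) * r + 30 * p * (r * r) + 5 * (r * r * r)) ⟩
    8 * (p * p) * (5 * p + 4 * r) + (28 * (p * p) * r + 30 * p * (r * r) + 5 * (r * r * r))
                                   ≡⟨ solve (p ∷ r ∷ []) ⟩
    5 * ((2 * p + r) * (2 * p + r) * (2 * p + r)) ∎
    where
    t≡5p+4r : t ≡ 5 * p + 4 * r
    t≡5p+4r = +-cancelˡ-≡ (3 * p) t (5 * p + 4 * r) (begin-equality
      3 * p + t                  ≡⟨ 3p+t≡4q ⟩
      4 * (2 * p + r)            ≡⟨ solve (p ∷ r ∷ []) ⟩
      3 * p + (5 * p + 4 * r)    ∎)

  -- (5/8) β^(4i+1) |A₀| ≥ β^(4i+4) |A| when |A₀| ≥ β|A| / (4 - 3β), as 8β²(4 - 3β) ≤ 5 for β ≤ 1/2.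
  final-size : ∀ {p q u v A A₀ X} → 1 ≤ p → 2 * p ≤ q → p * A + 3 * p * A₀ ≤ 4 * q * A₀ →
               5 * p * u * A₀ ≤ 8 * q * v * X → u * (p * p * p * p) * A ≤ v * (q * q * q * q) * X
  final-size {p} {q} {u} {v} {A} {A₀} {X} 1≤p 2p≤q pruned large = bound (m≤n⇒∃[o]m+o≡n 3p≤4q)
    where
    3p≤4q : 3 * p ≤ 4 * q
    3p≤4q = begin
      3 * p        ≤⟨ *-monoˡ-≤ p (m≤m+n 3 1) ⟩
      4 * p        ≡⟨ solve (p ∷ []) ⟩
      2 * (2 * p)  ≤⟨ *-monoʳ-≤ 2 2p≤q ⟩
      2 * q        ≤⟨ *-monoˡ-≤ q (m≤m+n 2 2) ⟩
      4 * q        ∎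
    bound : ∃ (λ t → 3 * p + t ≡ 4 * q) → u * (p * p * p * p) * A ≤ v * (q * q * q * q) * X
    bound (t , 3p+t≡4q) = *-cancelˡ-≤′ (5 * p) (≤-trans 1≤p (m≤n*m p 5)) (begin
      5 * p * (u * (p * p * p * p) * A)   ≡⟨ solve (p ∷ u ∷ A ∷ []) ⟩
      5 * u * (p * p * p * p) * (p * A)   ≤⟨ *-monoʳ-≤ (5 * u * (p * p * p * p)) pA≤tA₀ ⟩
      5 * u * (p * p * p * p) * (t * A₀)  ≡⟨ solve (u ∷ p ∷ t ∷ A₀ ∷ []) ⟩
      p * p * p * t * (5 * p * u * A₀)    ≤⟨ *-monoʳ-≤ (p * p * p * t) large ⟩
      p * p * p * t * (8 * q * v * X)     ≡⟨ solve (p ∷ t ∷ q ∷ v ∷ X ∷ []) ⟩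
      p * (8 * (p * p) * t) * (q * v * X) ≤⟨ *-monoˡ-≤ (q * v * X) (*-monoʳ-≤ p (cubic-bound {p} {q} 2p≤q 3p+t≡4q)) ⟩
      p * (5 * (q * q * q)) * (q * v * X) ≡⟨ solve (p ∷ q ∷ v ∷ X ∷ []) ⟩
      5 * p * (v * (q * q * q * q) * X)   ∎)
      where
      pA≤tA₀ : p * A ≤ t * A₀
      pA≤tA₀ = +-cancelʳ-≤ (3 * p * A₀) _ _ (begin
        p * A + 3 * p * A₀      ≤⟨ pruned ⟩
        4 * q * A₀              ≡⟨ cong (_* A₀) (sym 3p+t≡4q) ⟩
        (3 * p + t) * A₀        ≡⟨ solve (p ∷ t ∷ A₀ ∷ []) ⟩
        t * A₀ + 3 * p * A₀     ∎)


module Embedding where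

  open import Defs using (Tournament; edge; 𝟙; ∑)
  open Counting
  open Tournaments
  open Arithmetic
  open import Data.Bool using (Bool; true; false; not; _∧_; T)
  open import Data.Fin using (Fin)
  open import Data.List using (List; []; _∷_; [_]; length; _++_)
  open import Data.List.Properties using (length-++)
  open import Data.List.Relation.Unary.All as All using (All; []; _∷_)
  open import Data.List.Relation.Unary.All.Properties using (++⁺)
  open import Data.List.Relation.Unary.AllPairs using (AllPairs; []; _∷_)
  import Data.List.Relation.Unary.AllPairs.Properties as AllPairs
  open import Data.Nat using (ℕ; zero; suc; _+_; _*_; _^_; _≤_; _<_; _≤ᵇ_; z≤n; s≤s)
  open import Data.Nat.Properties
  open import Data.Sum using ([_,_]′)
  open import Data.Product using (∃; Σ; _×_; _,_; proj₁; proj₂)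
  open import Function using (_∘_)
  open import Relation.Binary.PropositionalEquality hiding ([_])
  open import Relation.Nullary using (¬_)

  module Chains {n : ℕ} (τ : Tournament n) (p q : ℕ) (1≤p : 1 ≤ p) (2p≤q : 2 * p ≤ q) where

    open Degrees τ
    open Degrees (reverse τ) using () renaming (deg to indeg; #-low-outdegree to #-low-indegree)

    1≤q : 1 ≤ q
    1≤q = ≤-trans 1≤p (≤-trans (m≤n*m p 2) 2p≤q)

    -- The slack + 1 lets density pass from B to N⁺ y B or N⁻ y B, which together with y
    -- make up B (dense-in-N⁻).
    Dense : VSet n → Fin n → Set
    Dense B a = 3 * p * # B ≤ 4 * q * (deg a B + 1)

    dense? : VSet n → Fin n → Bool
    dense? B a = 3 * p * # B ≤ᵇ 4 * q * (deg a B + 1)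

    AllDense : VSet n → VSet n → Set
    AllDense A B = ∀ a → T (A a) → Dense B a

    dense-in-N⁻ : (B : VSet n) (a y : Fin n) → T (B y) → T (edge τ a y) →
                  Dense B a → ¬ Dense (N⁺ y B) a → Dense (N⁻ y B) a
    dense-in-N⁻ B a y y∈B a→y dense sparse⁺ = split-dense {x = 3 * p} {y = 4 * q}
      (subst₂ (λ b d → 3 * p * b ≤ 4 * q * (d + 1)) (#-split-at B y y∈B) (deg-split-at B a y y∈B a→y) dense)
      (≰⇒> sparse⁺)

    Big : ℕ → ℕ → Set
    Big i b = q ^ (5 * suc i) ≤ p ^ (5 * suc i) * b

    Big⇒1≤ : ∀ i {b} → Big i b → 1 ≤ b
    Big⇒1≤ i big = 1≤*-cancelˡ (p ^ (5 * suc i)) (≤-trans (1≤^ (5 * suc i) 1≤q) big)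

    -- |X| ≥ (5/8)β^(4i+1)|A|: the first vertex of a chain costs (5/8)β, each further one β⁴.
    Large : ℕ → VSet n → VSet n → Set
    Large i A X = 5 * p * p ^ (4 * i) * # A ≤ 8 * q * q ^ (4 * i) * # X

    record Chain (A B : VSet n) (i : ℕ) : Set where
      field
        X          : VSet n
        ys         : List (Fin n)
        X⊆A        : X ⊆ᵥ A
        ys⊆B       : All (T ∘ B) ys
        length-ys  : length ys ≡ suc i
        transitive : AllPairs (λ u v → T (edge τ u v)) ys
        X⇒ys       : ∀ a → T (X a) → All (T ∘ edge τ a) ys
        large      : Large i A X

    ∑-dense : (A B : VSet n) → AllDense A B → 3 * p * # B * # A ≤ 4 * q * ∑∈ A (λ a → deg a B) + 4 * q * # A
    ∑-dense A B dense = begin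
      3 * p * # B * # A                                      ≡⟨ sym (∑∈-const A (3 * p * # B)) ⟩
      ∑∈ A (λ _ → 3 * p * # B)                               ≤⟨ ∑∈-mono-≤ A dense ⟩
      ∑∈ A (λ a → 4 * q * (deg a B + 1))                     ≡⟨ ∑∈-cong A (λ a → *-distribˡ-+ (4 * q) (deg a B) 1) ⟩
      ∑∈ A (λ a → 4 * q * deg a B + 4 * q * 1)               ≡⟨ ∑∈-distrib-+ A _ _ ⟩
      ∑∈ A (λ a → 4 * q * deg a B) + ∑∈ A (λ _ → 4 * q * 1)  ≡⟨ cong₂ _+_ (∑∈-*ˡ A (4 * q) (λ a → deg a B)) 4q#A ⟩
      4 * q * ∑∈ A (λ a → deg a B) + 4 * q * # A             ∎
      where
      open ≤-Reasoning
      4q#A : ∑∈ A (λ _ → 4 * q * 1) ≡ 4 * q * # A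
      4q#A = trans (∑∈-const A (4 * q * 1)) (cong (_* # A) (*-identityʳ (4 * q)))

    chain₀ : (A B : VSet n) → AllDense A B → 1 ≤ # A → Big 0 (# B) → Chain A B 0
    chain₀ A B dense 1≤#A big = record
      { X          = N⁻ y A
      ; ys         = [ y ]
      ; X⊆A        = λ a → ∧-elimˡ
      ; ys⊆B       = y∈B ∷ []
      ; length-ys  = refl
      ; transitive = [] ∷ []
      ; X⇒ys       = λ a a∈X → ∧-elimʳ {A a} a∈X ∷ []
      ; large      = subst₂ (λ x z → x * # A ≤ z * # (N⁻ y A)) (sym (*-identityʳ (5 * p))) (sym (*-identityʳ (8 * q)))
                       (base-size {p = p} {b = b} 1≤q 16q≤pb dense-sum S≤bc)
      }
      where
      b S : ℕ
      b = # B
      S = ∑∈ A (λ a → deg a B)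
      16q≤pb : 16 * q ≤ p * b
      16q≤pb = q⁵≤p⁵b⇒16q≤pb 1≤p 2p≤q (subst₂ (λ x z → x ≤ z * b) (^5≡ q) (^5≡ p) big)
      dense-sum : 3 * p * b * # A ≤ 4 * q * S + 4 * q * # A
      dense-sum = ∑-dense A B dense
      pigeon : ∃ λ y → T (B y) × ∑∈ B (λ y → # (N⁻ y A)) ≤ b * # (N⁻ y A)
      pigeon = ∃-≥-average B (λ y → # (N⁻ y A))
                 (subst (1 ≤_) (sym (∑-in-degrees A B)) (dense-sum-positive {p = p} {b = b} 1≤q 1≤#A 16q≤pb dense-sum))
      y : Fin n
      y = proj₁ pigeon
      y∈B : T (B y)
      y∈B = proj₁ (proj₂ pigeon)
      S≤bc : S ≤ b * # (N⁻ y A)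
      S≤bc = subst (_≤ b * # (N⁻ y A)) (∑-in-degrees A B) (proj₂ (proj₂ pigeon))

    module Step (i : ℕ) (chain-i : ∀ A B → AllDense A B → 1 ≤ # A → Big i (# B) → Chain A B i)
                (A B : VSet n) (dense : AllDense A B) (1≤#A : 1 ≤ # A) (big : Big (suc i) (# B)) where

      P M b : ℕ
      P = p ^ (5 * suc i)
      M = q ^ (5 * suc i)
      b = # B

      1≤P : 1 ≤ P
      1≤P = 1≤^ (5 * suc i) 1≤p

      big′ : M * (q * q * q * q * q) ≤ P * (p * p * p * p * p * b)
      big′ = subst₂ _≤_ (^5-suc q (suc i)) (trans (cong (_* b) (^5-suc p (suc i))) (*-assoc P _ b)) big

      16q≤pb : 16 * q ≤ p * b
      16q≤pb = q⁵≤p⁵b⇒16q≤pb 1≤p 2p≤q (*-cancelˡ-≤′ P 1≤P (≤-trans (*-monoˡ-≤ _ P≤M) big′))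
        where
        P≤M : P ≤ M
        P≤M = ^-monoˡ-≤ (5 * suc i) (≤-trans (m≤n*m p 2) 2p≤q)

      1≤b : 1 ≤ b
      1≤b = 1≤*-cancelˡ p (≤-trans 1≤q (≤-trans (m≤n*m q 16) 16q≤pb))

      rich⁺ rich⁻ : Fin n → Bool
      rich⁺ y = M ≤ᵇ P * deg y B
      rich⁻ y = M ≤ᵇ P * indeg y B

      G L⁺ L⁻ : VSet n
      G y  = B y ∧ (rich⁺ y ∧ rich⁻ y)
      L⁺ y = B y ∧ not (rich⁺ y)
      L⁻ y = B y ∧ not (rich⁻ y)

      #L⁺ : P * # L⁺ ≤ P + 2 * M
      #L⁺ = #-low-outdegree L⁺ B P M (λ _ → ∧-elimˡ) (λ u u∈L⁺ → <⇒≤ (≰ᵇ⇒> (∧-elimʳ {B u} u∈L⁺)))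

      #L⁻ : P * # L⁻ ≤ P + 2 * M
      #L⁻ = #-low-indegree L⁻ B P M (λ _ → ∧-elimˡ) (λ u u∈L⁻ → <⇒≤ (≰ᵇ⇒> (∧-elimʳ {B u} u∈L⁻)))

      deg-B≤ : ∀ a → deg a B ≤ (# L⁺ + # L⁻) + deg a G
      deg-B≤ a = ≤-trans (∑-mono-≤ pointwise) (≤-reflexive regroup)
        where
        regroup : ∑ (λ v → 𝟙 (L⁺ v) + 𝟙 (L⁻ v) + 𝟙 (G v) * E a v) ≡ (# L⁺ + # L⁻) + deg a G
        regroup = trans (∑-distrib-+ (λ v → 𝟙 (L⁺ v) + 𝟙 (L⁻ v)) (λ v → 𝟙 (G v) * E a v))
                        (cong (_+ deg a G) (∑-distrib-+ (𝟙 ∘ L⁺) (𝟙 ∘ L⁻)))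
        pointwise : ∀ v → 𝟙 (B v) * E a v ≤ 𝟙 (L⁺ v) + 𝟙 (L⁻ v) + 𝟙 (G v) * E a v
        pointwise v with B v | rich⁺ v | rich⁻ v | 𝟙≤1 (edge τ a v)
        ... | false | _     | _     | _   = z≤n
        ... | true  | false | _     | E≤1 = ≤-trans (≤-trans (≤-reflexive (+-identityʳ _)) E≤1) (s≤s z≤n)
        ... | true  | true  | false | E≤1 = ≤-trans (≤-trans (≤-reflexive (+-identityʳ _)) E≤1) (s≤s z≤n)
        ... | true  | true  | true  | _   = m≤n+m _ 0

      deg-G : ∀ a → T (A a) → 2 * (p * p * p * p) * b ≤ q * q * q * q * deg a G
      deg-G a a∈A = +-cancelˡ-≤ (q * q * q * q * (# L⁺ + # L⁻)) _ _ (begin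
        q * q * q * q * (# L⁺ + # L⁻) + 2 * (p * p * p * p) * b
          ≤⟨ degree-loss {p} {q} {b} 1≤p 2p≤q 16q≤pb (dense a a∈A) (low-degree-count {P} {M} 1≤P #L⁺ #L⁻ big′) ⟩
        q * q * q * q * deg a B
          ≤⟨ *-monoʳ-≤ (q * q * q * q) (deg-B≤ a) ⟩
        q * q * q * q * ((# L⁺ + # L⁻) + deg a G)
          ≡⟨ *-distribˡ-+ (q * q * q * q) (# L⁺ + # L⁻) (deg a G) ⟩
        q * q * q * q * (# L⁺ + # L⁻) + q * q * q * q * deg a G ∎)
        where open ≤-Reasoning

      SG : ℕ
      SG = ∑∈ A (λ a → deg a G)

      ∑deg-G : 2 * (p * p * p * p) * b * # A ≤ q * q * q * q * SG
      ∑deg-G = begin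
        2 * (p * p * p * p) * b * # A                 ≡⟨ sym (∑∈-const A (2 * (p * p * p * p) * b)) ⟩
        ∑∈ A (λ _ → 2 * (p * p * p * p) * b)          ≤⟨ ∑∈-mono-≤ A deg-G ⟩
        ∑∈ A (λ a → q * q * q * q * deg a G)          ≡⟨ ∑∈-*ˡ A (q * q * q * q) (λ a → deg a G) ⟩
        q * q * q * q * SG                            ∎
        where open ≤-Reasoning

      1≤p⁴#A : 1 ≤ p * p * p * p * # A
      1≤p⁴#A = *-mono-≤ (⁴-mono-≤ 1≤p) 1≤#A

      1≤SG : 1 ≤ SG
      1≤SG = 1≤*-cancelˡ (q * q * q * q) (≤-trans positive ∑deg-G)
        where
        positive : 1 ≤ 2 * (p * p * p * p) * b * # A
        positive = *-mono-≤ (*-mono-≤ (≤-trans (⁴-mono-≤ 1≤p) (m≤n*m (p * p * p * p) 2)) 1≤b) 1≤#A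

      pigeon : ∃ λ y → T (G y) × ∑∈ G (λ y → # (N⁻ y A)) ≤ # G * # (N⁻ y A)
      pigeon = ∃-≥-average G (λ y → # (N⁻ y A)) (subst (1 ≤_) (sym (∑-in-degrees A G)) 1≤SG)

      y : Fin n
      y = proj₁ pigeon

      y∈G : T (G y)
      y∈G = proj₁ (proj₂ pigeon)

      y∈B : T (B y)
      y∈B = ∧-elimˡ y∈G

      SG≤bc : SG ≤ b * # (N⁻ y A)
      SG≤bc = ≤-trans (subst (_≤ # G * # (N⁻ y A)) (∑-in-degrees A G) (proj₂ (proj₂ pigeon)))
                      (*-monoˡ-≤ (# (N⁻ y A)) (#-mono-⊆ {A = G} {B} (λ _ → ∧-elimˡ)))

      big⁺ : Big i (# (N⁺ y B))
      big⁺ = subst (λ d → M ≤ P * d) (sym (#N⁺≡deg y B)) (≤ᵇ⇒≤ M _ (∧-elimˡ (∧-elimʳ {B y} y∈G)))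

      big⁻ : Big i (# (N⁻ y B))
      big⁻ = subst (λ d → M ≤ P * d) (sym (#N⁻≡indeg y B)) (≤ᵇ⇒≤ M _ (∧-elimʳ {rich⁺ y} (∧-elimʳ {B y} y∈G)))

      A⁺ A⁻ : VSet n
      A⁺ a = N⁻ y A a ∧ dense? (N⁺ y B) a
      A⁻ a = N⁻ y A a ∧ not (dense? (N⁺ y B) a)

      large-part : (A′ : VSet n) → # (N⁻ y A) ≤ 2 * # A′ → p * p * p * p * # A ≤ q * q * q * q * # A′
      large-part A′ = halve {p * p * p * p} {# A} {q * q * q * q} 1≤b ∑deg-G SG≤bc

      extend : ∀ {A′ X} → Large i A′ X → p * p * p * p * # A ≤ q * q * q * q * # A′ → Large (suc i) A X
      extend {A′} {X} large A′≥A = subst₂ (λ u v → 5 * p * u * # A ≤ 8 * q * v * # X)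
        (sym (^4-suc p i)) (sym (^4-suc q i))
        (compose-ratios {a = 5 * p} {8 * q} {p ^ (4 * i)} {q ^ (4 * i)} {p * p * p * p} {q * q * q * q} large A′≥A)

      #N⁻-split : # (N⁻ y A) ≡ # A⁺ + # A⁻
      #N⁻-split = #-partition (N⁻ y A) (dense? (N⁺ y B))

      larger-half : ∀ {x z} → z ≤ x → x + z ≤ 2 * x
      larger-half {x} z≤x = ≤-trans (+-monoʳ-≤ x z≤x) (≤-reflexive (cong (x +_) (sym (+-identityʳ x))))

      positive : ∀ {A′ : VSet n} → p * p * p * p * # A ≤ q * q * q * q * # A′ → 1 ≤ # A′
      positive A′≥A = 1≤*-cancelˡ (q * q * q * q) (≤-trans 1≤p⁴#A A′≥A)

      prepend : # A⁻ ≤ # A⁺ → Chain A B (suc i)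
      prepend A⁻≤A⁺ = record
        { X          = X
        ; ys         = y ∷ ys
        ; X⊆A        = λ a a∈X → ∧-elimˡ (∧-elimˡ (X⊆A a a∈X))
        ; ys⊆B       = y∈B ∷ All.map (λ {v} → ∧-elimˡ {B v}) ys⊆B
        ; length-ys  = cong suc length-ys
        ; transitive = All.map (λ {v} → ∧-elimʳ {B v}) ys⊆B ∷ transitive
        ; X⇒ys       = λ a a∈X → ∧-elimʳ {A a} (∧-elimˡ (X⊆A a a∈X)) ∷ X⇒ys a a∈X
        ; large      = extend large A⁺≥A
        }
        where
        A⁺≥A : p * p * p * p * # A ≤ q * q * q * q * # A⁺
        A⁺≥A = large-part A⁺ (≤-trans (≤-reflexive #N⁻-split) (larger-half A⁻≤A⁺))
        dense⁺ : AllDense A⁺ (N⁺ y B)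
        dense⁺ a a∈A⁺ = ≤ᵇ⇒≤ _ _ (∧-elimʳ {N⁻ y A a} a∈A⁺)
        open Chain (chain-i A⁺ (N⁺ y B) dense⁺ (positive A⁺≥A) big⁺)

      append : # A⁺ < # A⁻ → Chain A B (suc i)
      append A⁺<A⁻ = record
        { X          = X
        ; ys         = ys ++ [ y ]
        ; X⊆A        = λ a a∈X → ∧-elimˡ (∧-elimˡ (X⊆A a a∈X))
        ; ys⊆B       = ++⁺ (All.map (λ {v} → ∧-elimˡ {B v}) ys⊆B) (y∈B ∷ [])
        ; length-ys  = trans (length-++ ys) (trans (cong (_+ 1) length-ys) (+-comm (suc i) 1))
        ; transitive = AllPairs.++⁺ transitive ([] ∷ []) (All.map (λ {v} v→y → ∧-elimʳ {B v} v→y ∷ []) ys⊆B)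
        ; X⇒ys       = λ a a∈X → ++⁺ (X⇒ys a a∈X) (∧-elimʳ {A a} (∧-elimˡ (X⊆A a a∈X)) ∷ [])
        ; large      = extend large A⁻≥A
        }
        where
        A⁻≥A : p * p * p * p * # A ≤ q * q * q * q * # A⁻
        A⁻≥A = large-part A⁻ (≤-trans (≤-reflexive (trans #N⁻-split (+-comm (# A⁺) (# A⁻)))) (larger-half (<⇒≤ A⁺<A⁻)))
        dense⁻ : AllDense A⁻ (N⁻ y B)
        dense⁻ a a∈A⁻ = dense-in-N⁻ B a y y∈B (∧-elimʳ {A a} a∈N⁻) (dense a (∧-elimˡ a∈N⁻))
                          (<⇒≱ (≰ᵇ⇒> (∧-elimʳ {N⁻ y A a} a∈A⁻)))
          where
          a∈N⁻ : T (N⁻ y A a)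
          a∈N⁻ = ∧-elimˡ a∈A⁻
        open Chain (chain-i A⁻ (N⁻ y B) dense⁻ (positive A⁻≥A) big⁻)

      chain-suc : Chain A B (suc i)
      chain-suc = [ prepend , append ]′ (≤-<-connex (# A⁻) (# A⁺))

    chain : ∀ i A B → AllDense A B → 1 ≤ # A → Big i (# B) → Chain A B i
    chain zero    = chain₀
    chain (suc i) = Step.chain-suc i (chain i)

    core : VSet n → VSet n → VSet n
    core A B a = A a ∧ (3 * p * # B ≤ᵇ 4 * q * deg a B)

    core-dense : (A B : VSet n) → AllDense (core A B) B
    core-dense A B a a∈core = ≤-trans (≤ᵇ⇒≤ _ _ (∧-elimʳ {A a} a∈core)) (*-monoʳ-≤ (4 * q) (m≤m+n _ 1))

    core-large : (A B : VSet n) → 1 ≤ # B → p * (# A * # B) ≤ q * ∑∑ A B E →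
                 p * # A + 3 * p * # (core A B) ≤ 4 * q * # (core A B)
    core-large A B 1≤b dense = subst (λ a → p * a + 3 * p * # A₀ ≤ 4 * q * # A₀) (sym #A-split)
      (prune {p} {q} 1≤b (subst (λ a → p * (a * b) ≤ q * e) #A-split dense) e≤)
      where
      b e : ℕ
      b = # B
      e = ∑∑ A B E
      A₀ Aᵣ : VSet n
      A₀ = core A B
      Aᵣ a = A a ∧ not (3 * p * # B ≤ᵇ 4 * q * deg a B)
      #A-split : # A ≡ # A₀ + # Aᵣ
      #A-split = #-partition A (λ a → 3 * p * # B ≤ᵇ 4 * q * deg a B)
      e≤ : 4 * q * e ≤ 4 * q * b * # A₀ + 3 * p * b * # Aᵣ
      e≤ = begin
        4 * q * e                                                   ≡⟨ cong (4 * q *_) (∑∑-∑∈ A B E) ⟩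
        4 * q * ∑∈ A (λ a → deg a B)                                ≡⟨ sym (∑∈-*ˡ A (4 * q) (λ a → deg a B)) ⟩
        ∑∈ A (λ a → 4 * q * deg a B)                                ≡⟨ ∑∈-partition A _ (λ a → 4 * q * deg a B) ⟩
        ∑∈ A₀ (λ a → 4 * q * deg a B) + ∑∈ Aᵣ (λ a → 4 * q * deg a B)
          ≤⟨ +-mono-≤ (∑∈-mono-≤ A₀ λ a _ → *-monoʳ-≤ (4 * q) (deg≤# a B))
                      (∑∈-mono-≤ Aᵣ λ a a∈Aᵣ → <⇒≤ (≰ᵇ⇒> (∧-elimʳ {A a} a∈Aᵣ))) ⟩
        ∑∈ A₀ (λ _ → 4 * q * b) + ∑∈ Aᵣ (λ _ → 3 * p * b)          ≡⟨ cong₂ _+_ (∑∈-const A₀ _) (∑∈-const Aᵣ _) ⟩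
        4 * q * b * # A₀ + 3 * p * b * # Aᵣ                        ∎
        where open ≤-Reasoning

    transitive-chain : ∀ i (A B : VSet n) → Big i (# A) → Big i (# B) → p * (# A * # B) ≤ q * ∑∑ A B E →
                       Σ (Chain (core A B) B i) λ c → p ^ (4 * suc i) * # A ≤ q ^ (4 * suc i) * # (Chain.X c)
    transitive-chain i A B big-A big-B dense = c ,
      subst₂ (λ u v → u * # A ≤ v * # X) (sym (^4-suc p i)) (sym (^4-suc q i))
             (final-size {p} {q} 1≤p 2p≤q pruned large)
      where
      pruned : p * # A + 3 * p * # (core A B) ≤ 4 * q * # (core A B)
      pruned = core-large A B (Big⇒1≤ i big-B) dense
      1≤#core : 1 ≤ # (core A B)
      1≤#core = 1≤*-cancelˡ (4 * q) (≤-trans (*-mono-≤ 1≤p (Big⇒1≤ i big-A)) (≤-trans (m≤m+n _ _) pruned))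
      c : Chain (core A B) B i
      c = chain i (core A B) B (core-dense A B) 1≤#core big-B
      open Chain c


module Subsets where

  open import Defs using (Tournament; edge; irrefl; Transitive; Disjoint; 𝟙; ∑)
  open Counting
  open import Data.Bool using (Bool; true; false; _∨_; T)
  open import Data.Bool.Properties using (T-≡)
  open import Data.Empty using (⊥-elim)
  open import Data.Fin as Fin using (Fin; zero; suc; _≟_)
  import Data.Fin.Properties as Fin
  open import Data.Fin.Subset using (Subset; _∈_; _⊆_; ∣_∣)
  open import Data.Fin.Subset.Properties using (_∈?_; x∈p∩q⁺; x∈p∩q⁻)
  open import Data.List using (List; []; _∷_; length; lookup)
  open import Data.List.Membership.Propositional using () renaming (_∈_ to _∈ₗ_)
  open import Data.List.Membership.Propositional.Properties using (∈-lookup)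
  import Data.List.Relation.Unary.All as All
  open import Data.List.Relation.Unary.AllPairs using (AllPairs; []; _∷_)
  open import Data.List.Relation.Unary.Any using (here; there; index)
  open import Data.List.Relation.Unary.Any.Properties using (lookup-index)
  open import Data.Nat as ℕ using (ℕ; zero; suc; _+_; _*_; s≤s)
  open import Data.Product using (∃; _,_; proj₁; proj₂)
  open import Data.Unit using (tt)
  open import Data.Vec using (tabulate; _∷_; [])
  open import Function using (_∘_; Injective; Equivalence; mk⇔)
  open import Relation.Binary.Definitions using (tri<; tri≈; tri>)
  open import Relation.Binary.PropositionalEquality
  open import Relation.Nullary using (¬_; does; yes; no)

  private variable n : ℕ

  χ : Subset n → VSet n
  χ A u = does (u ∈? A)

  ∣∣≡# : (A : Subset n) → ∣ A ∣ ≡ # (χ A)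
  ∣∣≡# []          = refl
  ∣∣≡# (true ∷ A)  = cong suc (∣∣≡# A)
  ∣∣≡# (false ∷ A) = ∣∣≡# A

  χ-tabulate : (f : VSet n) (u : Fin n) → χ (tabulate f) u ≡ f u
  χ-tabulate {suc n} f zero with f zero
  ... | true  = refl
  ... | false = refl
  χ-tabulate {suc n} f (suc u) = χ-tabulate (f ∘ suc) u

  ∈⇒χ : {A : Subset n} {u : Fin n} → u ∈ A → T (χ A u)
  ∈⇒χ {A = A} {u} u∈A with u ∈? A
  ... | yes _   = tt
  ... | no  u∉A = u∉A u∈A

  χ⇒∈ : {A : Subset n} {u : Fin n} → T (χ A u) → u ∈ A
  χ⇒∈ {A = A} {u} u∈A with u ∈? A
  ... | yes u∈A = u∈A

  ∈-tabulate⁻ : {f : VSet n} {u : Fin n} → u ∈ tabulate f → T (f u)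
  ∈-tabulate⁻ {f = f} {u} = subst T (χ-tabulate f u) ∘ ∈⇒χ

  ∈-tabulate⁺ : {f : VSet n} {u : Fin n} → T (f u) → u ∈ tabulate f
  ∈-tabulate⁺ {f = f} {u} = χ⇒∈ ∘ subst T (sym (χ-tabulate f u))

  ∣tabulate∣ : (f : VSet n) → ∣ tabulate f ∣ ≡ # f
  ∣tabulate∣ f = trans (∣∣≡# (tabulate f)) (∑-cong λ u → cong 𝟙 (χ-tabulate f u))

  Disjoint-⊆ : {A B X Y : Subset n} → X ⊆ A → Y ⊆ B → Disjoint A B → Disjoint X Y
  Disjoint-⊆ X⊆A Y⊆B A∩B≡∅ (u , u∈X∩Y) =
    A∩B≡∅ (u , x∈p∩q⁺ (X⊆A (proj₁ (x∈p∩q⁻ _ _ u∈X∩Y)) , Y⊆B (proj₂ (x∈p∩q⁻ _ _ u∈X∩Y))))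

  mem : List (Fin n) → VSet n
  mem []       v = false
  mem (x ∷ xs) v = δ x v ∨ mem xs v

  mem⇒∈ : (xs : List (Fin n)) {v : Fin n} → T (mem xs v) → v ∈ₗ xs
  mem⇒∈ (x ∷ xs) {v} v∈xs with x ≟ v
  ... | yes refl = here refl
  ... | no  _    = there (mem⇒∈ xs v∈xs)

  ∈⇒mem : {xs : List (Fin n)} {v : Fin n} → v ∈ₗ xs → T (mem xs v)
  ∈⇒mem {xs = x ∷ _} (here refl) with x ≟ x
  ... | yes _   = tt
  ... | no  x≢x = ⊥-elim (x≢x refl)
  ∈⇒mem {xs = x ∷ _} {v} (there v∈xs) with δ x v
  ... | true  = tt
  ... | false = ∈⇒mem v∈xs

  module OrderedLists {n : ℕ} (τ : Tournament n) where

    _→τ_ : Fin n → Fin n → Set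
    u →τ v = T (edge τ u v)

    ¬u→τu : ∀ u → ¬ (u →τ u)
    ¬u→τu u = subst T (irrefl τ u)

    #mem : {xs : List (Fin n)} → AllPairs _→τ_ xs → # (mem xs) ≡ length xs
    #mem {xs = []}     []            = ∑-zero {n}
    #mem {xs = x ∷ xs} (x→xs ∷ ordered) = begin
      ∑ (λ v → 𝟙 (δ x v ∨ mem xs v))           ≡⟨ ∑-cong disjoint-union ⟩
      ∑ (λ v → 𝟙 (δ x v) * 1 + 𝟙 (mem xs v))   ≡⟨ ∑-distrib-+ (λ v → 𝟙 (δ x v) * 1) (𝟙 ∘ mem xs) ⟩
      ∑ (λ v → 𝟙 (δ x v) * 1) + # (mem xs)     ≡⟨ cong₂ _+_ (∑-δ x (λ _ → 1)) (#mem ordered) ⟩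
      suc (length xs)                          ∎
      where
      open ≡-Reasoning
      disjoint-union : ∀ v → 𝟙 (δ x v ∨ mem xs v) ≡ 𝟙 (δ x v) * 1 + 𝟙 (mem xs v)
      disjoint-union v with x ≟ v
      ... | no  _    = refl
      ... | yes refl with mem xs x in x∈xs
      ...   | false = refl
      ...   | true  = ⊥-elim (¬u→τu x (All.lookup x→xs (mem⇒∈ xs (subst T (sym x∈xs) tt))))

    lookup-ordered : {xs : List (Fin n)} → AllPairs _→τ_ xs →
                     ∀ (i j : Fin (length xs)) → i Fin.< j → lookup xs i →τ lookup xs j
    lookup-ordered {xs = x ∷ xs} (x→xs ∷ _)       zero    (suc j) _         = All.lookup x→xs (∈-lookup j)
    lookup-ordered {xs = x ∷ xs} (_ ∷ ordered)    (suc i) (suc j) (s≤s i<j) = lookup-ordered ordered i j i<j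

    ∣mem∣ : {xs : List (Fin n)} → AllPairs _→τ_ xs → ∣ tabulate (mem xs) ∣ ≡ length xs
    ∣mem∣ {xs} ordered = trans (∣tabulate∣ (mem xs)) (#mem ordered)

    transitive-mem : {xs : List (Fin n)} → AllPairs _→τ_ xs → Transitive τ (tabulate (mem xs))
    transitive-mem {xs} ordered = σ , injective , (λ v → mk⇔ (onto v) (into v)) , increasing
      where
      σ : Fin ∣ tabulate (mem xs) ∣ → Fin n
      σ i = lookup xs (Fin.cast (∣mem∣ ordered) i)
      σ-ordered : ∀ i j → i Fin.< j → σ i →τ σ j
      σ-ordered i j i<j = lookup-ordered ordered _ _
        (subst₂ ℕ._<_ (sym (Fin.toℕ-cast (∣mem∣ ordered) i)) (sym (Fin.toℕ-cast (∣mem∣ ordered) j)) i<j)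
      increasing : ∀ i j → i Fin.< j → edge τ (σ i) (σ j) ≡ true
      increasing i j = Equivalence.to T-≡ ∘ σ-ordered i j
      injective : Injective _≡_ _≡_ σ
      injective {i} {j} σi≡σj with Fin.<-cmp i j
      ... | tri≈ _ i≡j _ = i≡j
      ... | tri< i<j _ _ = ⊥-elim (¬u→τu (σ j) (subst (_→τ σ j) σi≡σj (σ-ordered i j i<j)))
      ... | tri> _ _ j<i = ⊥-elim (¬u→τu (σ i) (subst (_→τ σ i) (sym σi≡σj) (σ-ordered j i j<i)))
      onto : ∀ v → v ∈ tabulate (mem xs) → ∃ λ i → σ i ≡ v
      onto v v∈Y = Fin.cast (sym (∣mem∣ ordered)) (index v∈xs) ,
                   trans (cong (lookup xs) (Fin.cast-involutive (∣mem∣ ordered) (sym (∣mem∣ ordered)) _))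
                         (sym (lookup-index v∈xs))
        where
        v∈xs : v ∈ₗ xs
        v∈xs = mem⇒∈ xs (∈-tabulate⁻ v∈Y)
      into : ∀ v → (∃ λ i → σ i ≡ v) → v ∈ tabulate (mem xs)
      into v (i , refl) = ∈-tabulate⁺ (∈⇒mem {xs = xs} (∈-lookup (Fin.cast (∣mem∣ ordered) i)))


module Fractions where

  open import Defs using (ℕtoℚ; _^_)
  open import Data.Integer as ℤ using (+_; +[1+_]; -[1+_]; +≤+; +<+)
  import Data.Integer.Properties as ℤ
  open import Data.Nat as ℕ using (ℕ; zero; suc; _*_; _≤_; z≤n; s≤s)
  import Data.Nat.Properties as ℕ
  open import Data.Product using (∃; ∃₂; _×_; _,_)
  open import Data.Rational as ℚ using (ℚ; mkℚ; toℚᵘ; 0ℚ; 1ℚ; ½; *<*)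
  import Data.Rational.Properties as ℚ
  open import Data.Rational.Unnormalised as ℚᵘ using (mkℚᵘ; *≡*; *≤*)
  import Data.Rational.Unnormalised.Properties as ℚᵘ
  open import Relation.Binary.PropositionalEquality

  -- x ≐ a / D says that x equals the fraction a / D, not necessarily in lowest terms;
  -- the denominator is kept positive by storing it as suc d.
  infix 4 _≐_/_

  _≐_/_ : ℚ → ℕ → ℕ → Set
  x ≐ a / D = ∃ λ d → suc d ≡ D × toℚᵘ x ℚᵘ.≃ mkℚᵘ (+ a) d

  ℕ≐ : ∀ a → ℕtoℚ a ≐ a / 1
  ℕ≐ a = 0 , refl , ℚ.toℚᵘ-fromℚᵘ (mkℚᵘ (+ a) 0)

  1≐ : 1ℚ ≐ 1 / 1
  1≐ = 0 , refl , ℚᵘ.≃-refl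

  ½≐ : ½ ≐ 1 / 2
  ½≐ = 1 , refl , ℚᵘ.≃-refl

  *-≐ : ∀ {x y a b D E} → x ≐ a / D → y ≐ b / E → x ℚ.* y ≐ a * b / D * E
  *-≐ {x} {y} {a} {b} (d , refl , x≃) (e , refl , y≃) = e ℕ.+ d * suc e , refl ,  -- suc d * suc e
    ℚᵘ.≃-trans (ℚ.toℚᵘ-homo-* x y)
      (ℚᵘ.≃-trans (ℚᵘ.*-cong x≃ y≃) (*≡* (cong (ℤ._* + suc (e ℕ.+ d * suc e)) (sym (ℤ.pos-* a b)))))

  ^-≐ : ∀ {x a D} → x ≐ a / D → ∀ m → x ^ m ≐ a ℕ.^ m / D ℕ.^ m
  ^-≐ x≐ zero    = 0 , refl , ℚᵘ.≃-refl
  ^-≐ x≐ (suc m) = *-≐ x≐ (^-≐ x≐ m)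

  ≤⇒cross-≤ : ∀ {x y a b D E} → x ≐ a / D → y ≐ b / E → x ℚ.≤ y → a * E ≤ b * D
  ≤⇒cross-≤ {x} {y} {a} {b} (d , refl , x≃) (e , refl , y≃) x≤y
    with ℚᵘ.≤-respʳ-≃ y≃ (ℚᵘ.≤-respˡ-≃ x≃ (ℚ.toℚᵘ-mono-≤ x≤y))
  ... | *≤* ad≤be = ℤ.drop‿+≤+ (subst₂ ℤ._≤_ (sym (ℤ.pos-* a (suc e))) (sym (ℤ.pos-* b (suc d))) ad≤be)

  cross-≤⇒≤ : ∀ {x y a b D E} → x ≐ a / D → y ≐ b / E → a * E ≤ b * D → x ℚ.≤ y
  cross-≤⇒≤ {x} {y} {a} {b} (d , refl , x≃) (e , refl , y≃) aE≤bD =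
    ℚ.toℚᵘ-cancel-≤ (ℚᵘ.≤-respʳ-≃ (ℚᵘ.≃-sym y≃) (ℚᵘ.≤-respˡ-≃ (ℚᵘ.≃-sym x≃)
      (*≤* (subst₂ ℤ._≤_ (ℤ.pos-* a (suc e)) (ℤ.pos-* b (suc d)) (+≤+ aE≤bD)))))

  positive-fraction : (β : ℚ) → 0ℚ ℚ.< β → ∃₂ λ p q → 1 ≤ p × β ≐ p / q
  positive-fraction (mkℚ +[1+ m ] d _) _                   = suc m , suc d , s≤s z≤n , d , refl , ℚᵘ.≃-refl
  positive-fraction (mkℚ (+ zero) d _) (*<* (+<+ ()))
  positive-fraction (mkℚ -[1+ m ] d _) (*<* ())

  ≤½⇒ : ∀ {x a D} → x ≐ a / D → x ℚ.≤ ½ → 2 * a ≤ D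
  ≤½⇒ {a = a} {D} x≐ x≤½ = subst₂ _≤_ (ℕ.*-comm a 2) (ℕ.*-identityˡ D) (≤⇒cross-≤ x≐ ½≐ x≤½)

  1≤*ℕ⇒ : ∀ {x a D} → x ≐ a / D → ∀ m → 1ℚ ℚ.≤ x ℚ.* ℕtoℚ m → D ≤ a * m
  1≤*ℕ⇒ {a = a} {D} x≐ m 1≤xm =
    subst₂ _≤_ (trans (ℕ.*-identityˡ _) (ℕ.*-identityʳ D)) (ℕ.*-identityʳ (a * m)) (≤⇒cross-≤ 1≐ (*-≐ x≐ (ℕ≐ m)) 1≤xm)

  *ℕ≤ℕ⇒ : ∀ {x a D} → x ≐ a / D → ∀ m k → x ℚ.* ℕtoℚ m ℚ.≤ ℕtoℚ k → a * m ≤ D * k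
  *ℕ≤ℕ⇒ {a = a} {D} x≐ m k xm≤k =
    subst₂ _≤_ (ℕ.*-identityʳ (a * m)) (trans (cong (k *_) (ℕ.*-identityʳ D)) (ℕ.*-comm k D))
      (≤⇒cross-≤ (*-≐ x≐ (ℕ≐ m)) (ℕ≐ k) xm≤k)

  *ℕ≤ℕ⇐ : ∀ {x a D} → x ≐ a / D → ∀ m k → a * m ≤ D * k → x ℚ.* ℕtoℚ m ℚ.≤ ℕtoℚ k
  *ℕ≤ℕ⇐ {a = a} {D} x≐ m k am≤Dk =
    cross-≤⇒≤ (*-≐ x≐ (ℕ≐ m)) (ℕ≐ k)
      (subst₂ _≤_ (sym (ℕ.*-identityʳ (a * m))) (trans (ℕ.*-comm D k) (cong (k *_) (sym (ℕ.*-identityʳ D)))) am≤Dk)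


module Natural where
  open import Defs using (Tournament; edge; e; Disjoint; Transitive; _⇒_)
  open Counting using (#; ∧-elimˡ)
  open Embedding using (module Chains)
  open Subsets
  open import Data.Bool.Properties using (T-≡)
  open import Data.Bool using (true)
  open import Data.Fin.Subset using (Subset; _⊆_; _∈_; ∣_∣)
  open import Data.List.Relation.Unary.All as All using ()
  open import Data.Nat using (ℕ; suc; _*_; _^_; _≤_)
  open import Data.Product using (Σ; _×_; _,_; proj₁; proj₂)
  open import Data.Vec using (tabulate)
  open import Function using (_∘_; Equivalence)
  open import Relation.Binary.PropositionalEquality

  dense-pair⇒transitive-subset :
    (i : ℕ) {n : ℕ} (τ : Tournament n) (A B : Subset n) → Disjoint A B →
    (p q : ℕ) → 1 ≤ p → 2 * p ≤ q →
    q ^ (5 * suc i) ≤ p ^ (5 * suc i) * ∣ A ∣ → q ^ (5 * suc i) ≤ p ^ (5 * suc i) * ∣ B ∣ →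
    p * (∣ A ∣ * ∣ B ∣) ≤ q * e τ A B →
    Σ (Subset n) λ X → Σ (Subset n) λ Y →
      X ⊆ A × Y ⊆ B × p ^ (4 * suc i) * ∣ A ∣ ≤ q ^ (4 * suc i) * ∣ X ∣ ×
      ∣ Y ∣ ≡ suc i × Transitive τ Y × _⇒_ τ X Y
  dense-pair⇒transitive-subset i {n} τ A B A∩B≡∅ p q 1≤p 2p≤q A-big B-big dense =
    X′ , Y′ , X′⊆A , Y′⊆B , size , trans (∣mem∣ transitive) length-ys , transitive-mem transitive ,
    Disjoint-⊆ X′⊆A Y′⊆B A∩B≡∅ , X′⇒Y′
    where
    open Chains τ p q 1≤p 2p≤q
    open OrderedLists τ
    result : Σ (Chain (core (χ A) (χ B)) (χ B) i) λ c → p ^ (4 * suc i) * # (χ A) ≤ q ^ (4 * suc i) * # (Chain.X c)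
    result = transitive-chain i (χ A) (χ B) (subst (Big i) (∣∣≡# A) A-big) (subst (Big i) (∣∣≡# B) B-big)
                              (subst₂ (λ a b → p * (a * b) ≤ q * e τ A B) (∣∣≡# A) (∣∣≡# B) dense)
    open Chain (proj₁ result)
    X′ Y′ : Subset n
    X′ = tabulate X
    Y′ = tabulate (mem ys)
    size : p ^ (4 * suc i) * ∣ A ∣ ≤ q ^ (4 * suc i) * ∣ X′ ∣
    size = subst₂ (λ a x → p ^ (4 * suc i) * a ≤ q ^ (4 * suc i) * x) (sym (∣∣≡# A)) (sym (∣tabulate∣ X)) (proj₂ result)
    X′⊆A : X′ ⊆ A
    X′⊆A = χ⇒∈ ∘ ∧-elimˡ ∘ X⊆A _ ∘ ∈-tabulate⁻
    Y′⊆B : Y′ ⊆ B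
    Y′⊆B = χ⇒∈ ∘ All.lookup ys⊆B ∘ mem⇒∈ ys ∘ ∈-tabulate⁻
    X′⇒Y′ : ∀ u v → u ∈ X′ → v ∈ Y′ → edge τ u v ≡ true
    X′⇒Y′ u v u∈X′ v∈Y′ = Equivalence.to T-≡ (All.lookup (X⇒ys u (∈-tabulate⁻ u∈X′)) (mem⇒∈ ys (∈-tabulate⁻ v∈Y′)))

open import Defs
open import Data.Nat using (ℕ; _*_; NonZero)
open import Data.Fin.Subset using (Subset; _⊆_; ∣_∣)
open import Data.Rational using (ℚ; _≤_; _<_; 0ℚ; ½; 1ℚ)
open import Data.Product using (Σ; _×_)
open import Relation.Binary.PropositionalEquality using (_≡_)
open import Data.Nat using (suc)
open import Data.Product using (_,_)
open Fractions
open Natural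

lemma2p4 : (k : ℕ) → .{{_ : NonZero k}} → {n : ℕ} → (T : Tournament n)
    → (A B : Subset n) → Disjoint A B
    → (β : ℚ) → 0ℚ < β → β ≤ ½
    → 1ℚ ≤ (β ^ (5 * k)) Data.Rational.* ℕtoℚ ∣ A ∣
    → 1ℚ ≤ (β ^ (5 * k)) Data.Rational.* ℕtoℚ ∣ B ∣
    → (β Data.Rational.* ℕtoℚ (∣ A ∣ * ∣ B ∣)) ≤ ℕtoℚ (e T A B)
    → Σ (Subset n) λ X → Σ (Subset n) λ Y →
    X ⊆ A × Y ⊆ B
    × (β ^ (4 * k)) Data.Rational.* ℕtoℚ ∣ A ∣ ≤ ℕtoℚ ∣ X ∣
    × ∣ Y ∣ ≡ k
    × Transitive T Y
    × _⇒_ T X Y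
lemma2p4 (suc i) T A B A∩B≡∅ β 0<β β≤½ A-big B-big dense with positive-fraction β 0<β
... | p , q , 1≤p , β≐p/q =
  let X , Y , X⊆A , Y⊆B , size , Y-transitive-chain =
        dense-pair⇒transitive-subset i T A B A∩B≡∅ p q 1≤p (≤½⇒ β≐p/q β≤½)
          (1≤*ℕ⇒ (^-≐ β≐p/q (5 * suc i)) ∣ A ∣ A-big) (1≤*ℕ⇒ (^-≐ β≐p/q (5 * suc i)) ∣ B ∣ B-big)
          (*ℕ≤ℕ⇒ β≐p/q (∣ A ∣ * ∣ B ∣) (e T A B) dense)
  in X , Y , X⊆A , Y⊆B , *ℕ≤ℕ⇐ (^-≐ β≐p/q (4 * suc i)) ∣ A ∣ ∣ X ∣ size , Y-transitive-chain
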